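{- Let $\vec r,\vec s$ be two crossing separations in a distributive universe $\vec U$, and let $\vec r',\vec s'$ be any unscrambling of them. Then $\vec r'=\vec r\wedge\overleftarrow s'$ and $\vec s'=\vec s\wedge\overleftarrow r'$.
   Context: A universe $\vec U$ is a lattice ($\vee,\wedge$) with an order-reversing involution $\vec x\mapsto\overleftarrow x$; distributive if the lattice is distributive. Two separations cross if no orientation of one is comparable with an orientation of the other. For crossing $\vec r,\vec s\in\vec U$, an unscrambling of $\vec r,\vec s$ is a pair $\vec r',\vec s'\in\vec U$ with $\vec r\wedge\overleftarrow s\le\vec r'\le\vec r$, $\vec s\wedge\overleftarrow r\le\vec s'\le\vec s$, and at least one of $\vec s'=\vec s\wedge\overleftarrow r'$ and $\vec r'=\vec r\wedge\overleftarrow s'$. -}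

module Defs where

open import Level using (Level; _⊔_) renaming (suc to lsuc)
open import Algebra.Lattice.Bundles using (DistributiveLattice)
open import Relation.Binary.Core using (Rel)
open import Relation.Nullary using (¬_)
open import Data.Product using (_×_)
open import Data.Sum using (_⊎_)

-- A distributive universe of separations: a distributive lattice with an
-- order-reversing involution x ↦ x * (the inverse orientation).
record DistributiveUniverse (c ℓ : Level) : Set (lsuc (c ⊔ ℓ)) where
  field
    distLattice : DistributiveLattice c ℓ
  open DistributiveLattice distLattice public
  _≤_ : Rel Carrier ℓ
  x ≤ y = (x ∧ y) ≈ x
  infix 8 _*
  field
    _*        : Carrier → Carrier
    *-cong    : ∀ {x y} → x ≈ y → (x *) ≈ (y *)
    *-involutive : ∀ x → ((x *) *) ≈ x
    *-antitone   : ∀ {x y} → x ≤ y → (y *) ≤ (x *)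

module _ {c ℓ : Level} (U : DistributiveUniverse c ℓ) where
  open DistributiveUniverse U

  Comparable : Carrier → Carrier → Set ℓ
  Comparable x y = x ≤ y ⊎ y ≤ x

  Cross : Carrier → Carrier → Set ℓ
  Cross r s = ¬ Comparable r s × ¬ Comparable r (s *)
            × ¬ Comparable (r *) s × ¬ Comparable (r *) (s *)

  Unscrambling : Carrier → Carrier → Carrier → Carrier → Set ℓ
  Unscrambling r s r' s' =
      ((r ∧ (s *)) ≤ r') × (r' ≤ r)
    × ((s ∧ (r *)) ≤ s') × (s' ≤ s)
    × (s' ≈ (s ∧ (r' *)) ⊎ r' ≈ (r ∧ (s' *)))

{-# OPTIONS --safe #-}
module Submission where

-- In a distributive lattice with an order-reversing involution, De Morgan's
-- law (s ∧ r'*)* ≈ s* ∨ r' and distributivity turn r ∧ (s ∧ r'*)* into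
-- (r ∧ s*) ∨ (r ∧ r'), which collapses to r' as soon as r ∧ s* ≤ r' ≤ r.
-- So either of the two unscrambling identities implies the other.

open import Defs
open import Level using (Level)
open import Data.Product using (_×_; _,_; proj₁)
open import Data.Sum using (inj₁; inj₂)
open import Algebra.Lattice.Properties.Lattice using (∨-∧-orderTheoreticLattice)
import Relation.Binary.Lattice.Bundles as OrderTheoretic
import Relation.Binary.Lattice.Properties.JoinSemilattice as JoinSemilatticeProperties
import Relation.Binary.Reasoning.Setoid as SetoidReasoning

module _ {c ℓ : Level} (U : DistributiveUniverse c ℓ) where
  open DistributiveUniverse U

  private
    module O = OrderTheoretic.Lattice (∨-∧-orderTheoreticLattice lattice)
    open JoinSemilatticeProperties O.joinSemilattice using (x≤y⇒x∨y≈y)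

  -- The standard library orders a lattice by x ≈ x ∧ y, the symmetric form
  -- of the order x ∧ y ≈ x used for universes.
  infix 4 _⊑_
  _⊑_ : Carrier → Carrier → Set ℓ
  _⊑_ = O._≤_

  ≤⇒⊑ : ∀ {x y} → x ≤ y → x ⊑ y
  ≤⇒⊑ = sym

  *-antitone-⊑ : ∀ {x y} → x ⊑ y → y * ⊑ x *
  *-antitone-⊑ x⊑y = ≤⇒⊑ (*-antitone (sym x⊑y))

  *-swap-⊑ : ∀ {x y} → x * ⊑ y → y * ⊑ x
  *-swap-⊑ {x} x*⊑y = O.≤-respʳ-≈ (*-involutive x) (*-antitone-⊑ x*⊑y)

  *-∧-deMorgan : ∀ x y → (x ∧ y) * ≈ x * ∨ y *
  *-∧-deMorgan x y = O.antisym
    (*-swap-⊑ (O.∧-greatest (*-swap-⊑ (O.x≤x∨y (x *) (y *)))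
                            (*-swap-⊑ (O.y≤x∨y (x *) (y *)))))
    (O.∨-least (*-antitone-⊑ (O.x∧y≤x x y)) (*-antitone-⊑ (O.x∧y≤y x y)))

  unscrambling-identity-dual : ∀ {r s r′ s′} → (r ∧ s *) ≤ r′ → r′ ≤ r →
                               s′ ≈ s ∧ r′ * → r′ ≈ r ∧ s′ *
  unscrambling-identity-dual {r} {s} {r′} {s′} r∧s*≤r′ r′≤r s′≈s∧r′* = sym (begin
    r ∧ s′ *               ≈⟨ ∧-congˡ (*-cong s′≈s∧r′*) ⟩
    r ∧ (s ∧ r′ *) *       ≈⟨ ∧-congˡ (*-∧-deMorgan s (r′ *)) ⟩
    r ∧ (s * ∨ r′ * *)     ≈⟨ ∧-congˡ (∨-congˡ (*-involutive r′)) ⟩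
    r ∧ (s * ∨ r′)         ≈⟨ proj₁ ∧-distrib-∨ r (s *) r′ ⟩
    r ∧ s * ∨ r ∧ r′       ≈⟨ ∨-congˡ (trans (∧-comm r r′) r′≤r) ⟩
    r ∧ s * ∨ r′           ≈⟨ x≤y⇒x∨y≈y (≤⇒⊑ r∧s*≤r′) ⟩
    r′                     ∎)
    where open SetoidReasoning setoid

proposition5p4 : {c ℓ : Level} (U : DistributiveUniverse c ℓ)
    → let open DistributiveUniverse U in
      (r s r' s' : Carrier)
    → Cross U r s
    → Unscrambling U r s r' s'
    → (r' ≈ (r ∧ (s' *))) × (s' ≈ (s ∧ (r' *)))
proposition5p4 U r s r' s' _ (r∧s*≤r' , r'≤r , _ , _ , inj₁ s'≈s∧r'*) =
  unscrambling-identity-dual U r∧s*≤r' r'≤r s'≈s∧r'* , s'≈s∧r'*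
proposition5p4 U r s r' s' _ (_ , _ , s∧r*≤s' , s'≤s , inj₂ r'≈r∧s'*) =
  r'≈r∧s'* , unscrambling-identity-dual U s∧r*≤s' s'≤s r'≈r∧s'*
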